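{- For every symmetric $0,1$-matrix $M$ and every natural number $k$, if $M$ does not have a $k$-wide division, then $M$ admits a sequence of symmetric $2(k+1)$-diagonal divisions.
   Context: Let $M$ be a symmetric $n\times n$ $0,1$-matrix with rows $r_1,\dots,r_n$ and columns $c_1,\dots,c_n$. A symmetric partition of $M$ is a pair $(\mathcal R,\mathcal C)$ with $\mathcal R$ a partition of the rows and $\mathcal C$ a partition of the columns such that $r_i,r_j$ lie in the same part iff $c_i,c_j$ do. A symmetric partition sequence of $M$ is a sequence $(\mathcal R_n,\mathcal C_n),\dots,(\mathcal R_1,\mathcal C_1)$ of symmetric partitions, starting with the partition into singletons, ending with one row part and one column part, each obtained from the previous one by merging two row parts and the two symmetric column parts. A (symmetric) division is a symmetric partition whose parts consist of consecutive rows (columns), written $(R_1,\dots,R_p)$, $(C_1,\dots,C_p)$ in order, $C_i$ symmetric to $R_i$. A row part $R_i$ is $k$-wide if for every $k$ consecutive column parts $C_j,\dots,C_{j+k-1}$ with $j\le i\le j+k-1$, the submatrix with rows $R_i$ and all columns outside $C_j\cup\dots\cup C_{j+k-1}$ has at least $k$ distinct rows; symmetrically for column parts. A division is $k$-wide if all its row and column parts are $k$-wide, and $k$-diagonal if none of its row and column parts is $k$-wide. A sequence of symmetric $k$-diagonal divisions is a symmetric partition sequence each of whose partitions is a $k$-diagonal division. -}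

module Defs where

open import Data.Nat using (ℕ; zero; suc; _+_; _*_; _≤_; _<_)
import Data.Fin
open import Data.Fin using (Fin; toℕ; inject₁) renaming (suc to fsuc; _≤_ to _≤ᶠ_)
open import Data.Bool using (Bool)
open import Data.Product using (Σ; ∃; _×_; _,_)
open import Data.Sum using (_⊎_)
open import Relation.Nullary using (¬_)
open import Relation.Binary.PropositionalEquality using (_≡_; _≢_)
open import Function.Bundles using (_⇔_)

-- An n×n 0,1-matrix: entry (i , j) = row i, column j.
Matrix : ℕ → Set
Matrix n = Fin n → Fin n → Bool

Symmetric : {n : ℕ} → Matrix n → Set
Symmetric {n} M = ∀ (i j : Fin n) → M i j ≡ M j i

-- A symmetric division of an n×n matrix: p parts of consecutive indices,
-- given by the (monotone, surjective) map sending index i to the label of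
-- its part.  Row part R_a = {r_i : part i ≡ a}, column part C_a likewise
-- (the same map, so C_a is symmetric to R_a).
record Division (n : ℕ) : Set where
  field
    p         : ℕ
    part      : Fin n → Fin p
    monotone  : ∀ {i j : Fin n} → i ≤ᶠ j → part i ≤ᶠ part j
    surjective : ∀ (a : Fin p) → ∃ λ i → part i ≡ a
open Division public

-- Window of k consecutive part labels C_j,…,C_{j+k-1}, where j = t - k may
-- be negative / the window may stick out past the last part (non-existing
-- parts are empty).
InWindow : ℕ → ℕ → ℕ → Set
InWindow k t l = (t ≤ l + k) × (l < t)

RowWide : {n : ℕ} → Matrix n → ℕ → (D : Division n) → Fin (p D) → Set
RowWide {n} M k D a =
  ∀ (t : ℕ) → InWindow k t (toℕ a) →
    Σ (Fin k → Fin n) λ r →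
      (∀ x → part D (r x) ≡ a) ×
      (∀ x y → x ≢ y →
        ∃ λ (c : Fin n) → ¬ InWindow k t (toℕ (part D c)) × M (r x) c ≢ M (r y) c)

ColWide : {n : ℕ} → Matrix n → ℕ → (D : Division n) → Fin (p D) → Set
ColWide {n} M k D a =
  ∀ (t : ℕ) → InWindow k t (toℕ a) →
    Σ (Fin k → Fin n) λ c →
      (∀ x → part D (c x) ≡ a) ×
      (∀ x y → x ≢ y →
        ∃ λ (r : Fin n) → ¬ InWindow k t (toℕ (part D r)) × M r (c x) ≢ M r (c y))

KWide : {n : ℕ} → Matrix n → ℕ → Division n → Set
KWide M k D = ∀ a → RowWide M k D a × ColWide M k D a

KDiagonal : {n : ℕ} → Matrix n → ℕ → Division n → Set
KDiagonal M k D = ∀ a → ¬ RowWide M k D a × ¬ ColWide M k D a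

Same : {n : ℕ} → Division n → Fin n → Fin n → Set
Same D i j = part D i ≡ part D j

Singletons : {n : ℕ} → Division n → Set
Singletons D = ∀ i j → Same D i j → i ≡ j

OnePart : {n : ℕ} → Division n → Set
OnePart D = p D ≡ 1

MergeStep : {n : ℕ} → Division n → Division n → Set
MergeStep {n} D E =
  Σ (Fin (p D)) λ a → Σ (Fin (p D)) λ b → (a ≢ b) ×
    (∀ i j → Same E i j ⇔
       (Same D i j ⊎ ((part D i ≡ a ⊎ part D i ≡ b) × (part D j ≡ a ⊎ part D j ≡ b))))

record SymDiagSeq {n : ℕ} (M : Matrix n) (k : ℕ) : Set where
  field
    len      : ℕ
    stage    : Fin (suc len) → Division n
    first    : Singletons (stage Data.Fin.zero)
    last     : OnePart (stage (Data.Fin.fromℕ len))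
    step     : ∀ (t : Fin len) → MergeStep (stage (inject₁ t)) (stage (fsuc t))
    diagonal : ∀ (t : Fin (suc len)) → KDiagonal M k (stage t)

{-# OPTIONS --safe #-}
module Submission where

open import Defs
open import Data.Nat using (ℕ; suc; _*_)
open import Data.Product using (Σ)
open import Relation.Nullary using (¬_)

open import Data.Nat using (zero; _+_; _≤_; _<_; z≤n; s≤s; s≤s⁻¹; _≤?_; _<?_; ⌊_/2⌋; _⊓_)
open import Data.Nat.Properties
open import Data.Nat.Tactic.RingSolver using (solve-∀)
open import Data.Fin using (Fin; toℕ; fromℕ; fromℕ<; inject₁; inject≤; pinch; finToFun; funToFin)
  renaming (zero to fzero; suc to fsuc; _≤_ to _≤ᶠ_)
import Data.Fin.Properties as Fin
open import Data.Bool.Properties using () renaming (_≟_ to _≟ᵇ_)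
open import Data.Product using (∃; _×_; _,_; proj₁; proj₂)
open import Data.Sum using (_⊎_; inj₁; inj₂; [_,_]′)
open import Data.Empty using (⊥-elim)
open import Relation.Nullary using (Dec; yes; no; ¬?)
open import Relation.Nullary.Decidable using (map′; _×-dec_; _→-dec_)
open import Relation.Unary using (Decidable)
open import Relation.Binary.Definitions using (Monotonic₁)
open import Relation.Binary.PropositionalEquality
  using (_≡_; _≢_; _≗_; refl; sym; trans; cong; subst; subst₂)
open import Function using (_∘_; id; flip)
open import Function.Bundles using (_⇔_; mk⇔; module Equivalence)

-- Start from the division into singletons, which is 2(k+1)-diagonal, and
-- repeatedly merge two adjacent parts.  Merging parts j and j+1 of a
-- diagonal division leaves every other part non-wide, so it only fails to
-- give a diagonal division when the merged part is 2(k+1)-wide.  If that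
-- happened for every j, group the parts in consecutive pairs (the last group
-- possibly a triple): group a contains the merged part 2a, and k consecutive
-- groups lie within 2(k+1) consecutive parts, so every group inherits
-- k-wideness from the merged part it contains.  That k-wide division is
-- excluded, and since wideness is decidable some merge stays diagonal.

anyFun? : ∀ {m n} {P : (Fin m → Fin n) → Set} →
          (∀ {r r′} → r ≗ r′ → P r → P r′) → Decidable P → Dec (∃ P)
anyFun? {m} {n} resp P? =
  map′ (λ (i , Pi) → finToFun i , Pi)
       (λ (r , Pr) → funToFin r , resp (sym ∘ Fin.finToFun-funToFin r) Pr)
       (Fin.any? (P? ∘ finToFun {n} {m}))

allℕ? : ∀ {P : ℕ → Set} → Decidable P → ∀ B → (∀ {t} → B ≤ t → P t) → Dec (∀ t → P t)
allℕ? {P} P? B beyond = map′ everywhere (λ all {t} _ → all t) (allUpTo? P? B)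
  where
  everywhere : (∀ {t} → t < B → P t) → ∀ t → P t
  everywhere below t = [ below , beyond ]′ (<-≤-connex t B)

inWindow? : ∀ K t l → Dec (InWindow K t l)
inWindow? K t l = (t ≤? l + K) ×-dec (l <? t)

SeparatedRows : ∀ {n} → Matrix n → (K : ℕ) (D : Division n) → Fin (p D) → ℕ → (Fin K → Fin n) → Set
SeparatedRows {n} M K D a t r =
  (∀ x → part D (r x) ≡ a) ×
  (∀ x y → x ≢ y →
    ∃ λ (c : Fin n) → ¬ InWindow K t (toℕ (part D c)) × M (r x) c ≢ M (r y) c)

module _ {n} (M : Matrix n) (K : ℕ) (D : Division n) (a : Fin (p D)) where

  separatedRows? : ∀ t → Decidable (SeparatedRows M K D a t)
  separatedRows? t r =
    Fin.all? (λ x → part D (r x) Fin.≟ a) ×-dec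
    Fin.all? (λ x → Fin.all? (λ y → ¬? (x Fin.≟ y) →-dec
      Fin.any? (λ c → ¬? (inWindow? K t (toℕ (part D c))) ×-dec ¬? (M (r x) c ≟ᵇ M (r y) c))))

  separatedRows-resp : ∀ t {r r′} → r ≗ r′ → SeparatedRows M K D a t r → SeparatedRows M K D a t r′
  separatedRows-resp t r≗r′ (inPart , separated) =
    (λ x → subst (λ i → part D i ≡ a) (r≗r′ x) (inPart x)) ,
    λ x y x≢y → let (c , outside , differ) = separated x y x≢y in
      c , outside , λ eq → differ (subst₂ (λ i i′ → M i c ≡ M i′ c) (sym (r≗r′ x)) (sym (r≗r′ y)) eq)

  RowWide? : Dec (RowWide M K D a)
  RowWide? = allℕ? (λ t → inWindow? K t (toℕ a) →-dec anyFun? (separatedRows-resp t) (separatedRows? t))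
                   (suc (toℕ a + K)) (λ beyond w → ⊥-elim (<⇒≱ beyond (proj₁ w)))

-- ColWide M is RowWide of the transpose of M, definitionally.
RowWide-cong : ∀ {n} {M N : Matrix n} {K D a} → (∀ i j → M i j ≡ N i j) →
               RowWide M K D a → RowWide N K D a
RowWide-cong M≡N W t w =
  let (r , inPart , separated) = W t w in
  r , inPart , λ x y x≢y → let (c , outside , differ) = separated x y x≢y in
    c , outside , λ eq → differ (trans (M≡N _ c) (trans eq (sym (M≡N _ c))))

module _ {n} {M : Matrix n} (S : Symmetric M) {K : ℕ} {D : Division n} where

  RowWide⇒ColWide : ∀ {a} → RowWide M K D a → ColWide M K D a
  RowWide⇒ColWide {a} = RowWide-cong {K = K} {D} {a} S

  ColWide⇒RowWide : ∀ {a} → ColWide M K D a → RowWide M K D a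
  ColWide⇒RowWide {a} = RowWide-cong {K = K} {D} {a} (flip S)

  KDiagonal-fromRows : (∀ a → ¬ RowWide M K D a) → KDiagonal M K D
  KDiagonal-fromRows notWide a = notWide a , notWide a ∘ ColWide⇒RowWide

-- No window hypothesis on b is needed: b is hit by some i, which lies in part a.
RowWide-transfer : ∀ {n} {M : Matrix n} {K K′} {D E : Division n} {a b} → K ≤ K′ →
  (∀ i → part E i ≡ b → part D i ≡ a) →
  (∀ t → InWindow K t (toℕ a) → ∃ λ t′ →
     ∀ c → InWindow K t (toℕ (part D c)) → InWindow K′ t′ (toℕ (part E c))) →
  RowWide M K′ E b → RowWide M K D a
RowWide-transfer {K = K} {K′} {E = E} {a} {b} K≤K′ rows windows W t w =
  let (t′ , window) = windows t w
      (i , Ei≡b) = surjective E b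
      b∈window = subst (InWindow K′ t′ ∘ toℕ) Ei≡b
                   (window i (subst (InWindow K t ∘ toℕ) (sym (rows i Ei≡b)) w))
      (r , inPart , separated) = W t′ b∈window
  in r ∘ shrink , rows _ ∘ inPart ∘ shrink ,
     λ x y x≢y → let (c , outside , differ) = separated (shrink x) (shrink y) (x≢y ∘ shrink-injective x y)
                 in c , outside ∘ window c , differ
  where
  shrink : Fin K → Fin K′
  shrink x = inject≤ x K≤K′
  shrink-injective : ∀ x y → shrink x ≡ shrink y → x ≡ y
  shrink-injective = Fin.inject≤-injective K≤K′ K≤K′

division : ∀ {n q} (f : Fin n → Fin q) → Monotonic₁ _≤ᶠ_ _≤ᶠ_ f → (∀ a → ∃ λ i → f i ≡ a) → Division n
division f mono onto = record { p = _ ; part = f ; monotone = mono ; surjective = onto }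

singletons : ∀ n → Division n
singletons n = division id id (λ a → a , refl)

singletons-diagonal : ∀ {n} {M : Matrix n} → Symmetric M → ∀ {K} → 2 ≤ K → KDiagonal M K (singletons n)
singletons-diagonal {n} {M} S {K} (s≤s (s≤s _)) = KDiagonal-fromRows S {K} {singletons n} notWide
  where
  notWide : ∀ a → ¬ RowWide M K (singletons n) a
  notWide a W =
    let (r , inPart , separated) = W (suc (toℕ a)) (m<m+n (toℕ a) (s≤s z≤n) , ≤-refl)
        (c , _ , differ) = separated fzero (fsuc fzero) (λ ())
    in differ (cong (λ i → M i c) (trans (inPart fzero) (sym (inPart (fsuc fzero)))))

private
  variable
    s : ℕ

toℕ-pinch : ∀ (j : Fin s) x →
  (toℕ x ≤ toℕ j × toℕ (pinch j x) ≡ toℕ x) ⊎ (toℕ j < toℕ x × suc (toℕ (pinch j x)) ≡ toℕ x)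
toℕ-pinch fzero    fzero    = inj₁ (z≤n , refl)
toℕ-pinch fzero    (fsuc x) = inj₂ (s≤s z≤n , refl)
toℕ-pinch (fsuc j) fzero    = inj₁ (z≤n , refl)
toℕ-pinch (fsuc j) (fsuc x) with toℕ-pinch j x
... | inj₁ (x≤j , eq) = inj₁ (s≤s x≤j , cong suc eq)
... | inj₂ (j<x , eq) = inj₂ (s≤s j<x , cong suc eq)

toℕ-pinch-≤ : ∀ (j : Fin s) x → toℕ (pinch j x) ≤ toℕ x
toℕ-pinch-≤ j x with toℕ-pinch j x
... | inj₁ (_ , eq) = ≤-reflexive eq
... | inj₂ (_ , eq) = subst (toℕ (pinch j x) ≤_) eq (n≤1+n _)

toℕ-≤-suc-pinch : ∀ (j : Fin s) x → toℕ x ≤ suc (toℕ (pinch j x))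
toℕ-≤-suc-pinch j x with toℕ-pinch j x
... | inj₁ (_ , eq) = subst (_≤ suc (toℕ (pinch j x))) eq (n≤1+n _)
... | inj₂ (_ , eq) = ≤-reflexive (sym eq)

pinch-inject₁ : ∀ (j : Fin s) → pinch j (inject₁ j) ≡ j
pinch-inject₁ fzero    = refl
pinch-inject₁ (fsuc j) = cong fsuc (pinch-inject₁ j)

pinch-suc : ∀ (j : Fin s) → pinch j (fsuc j) ≡ j
pinch-suc fzero    = refl
pinch-suc (fsuc j) = cong fsuc (pinch-suc j)

suc≢inject₁ : ∀ {j : Fin s} → fsuc j ≢ inject₁ j
suc≢inject₁ {j = fsuc j} eq = suc≢inject₁ (Fin.suc-injective eq)

Pinched : Fin s → Fin (suc s) → Set
Pinched j x = x ≡ inject₁ j ⊎ x ≡ fsuc j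

pinch≡⇒Pinched : ∀ (j : Fin s) {x} → pinch j x ≡ j → Pinched j x
pinch≡⇒Pinched j {x} eq with x Fin.≟ fsuc j
... | yes x≡1+j = inj₂ x≡1+j
... | no  x≢1+j = inj₁ (Fin.pinch-injective (x≢1+j ∘ sym) suc≢inject₁ (trans eq (sym (pinch-inject₁ j))))

Pinched⇒pinch≡ : ∀ (j : Fin s) {x} → Pinched j x → pinch j x ≡ j
Pinched⇒pinch≡ j (inj₁ refl) = pinch-inject₁ j
Pinched⇒pinch≡ j (inj₂ refl) = pinch-suc j

pinch-≡-⇔ : ∀ (j : Fin s) x y → pinch j x ≡ pinch j y ⇔ (x ≡ y ⊎ (Pinched j x × Pinched j y))
pinch-≡-⇔ j x y = mk⇔ to from
  where
  ≢suc : ∀ {z} → pinch j z ≢ j → fsuc j ≢ z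
  ≢suc z↛j 1+j≡z = z↛j (subst (λ w → pinch j w ≡ j) 1+j≡z (pinch-suc j))
  to : pinch j x ≡ pinch j y → x ≡ y ⊎ (Pinched j x × Pinched j y)
  to eq with pinch j x Fin.≟ j
  ... | yes x↦j = inj₂ (pinch≡⇒Pinched j x↦j , pinch≡⇒Pinched j (trans (sym eq) x↦j))
  ... | no  x↛j = inj₁ (Fin.pinch-injective (≢suc x↛j) (≢suc (x↛j ∘ trans eq)) eq)
  from : x ≡ y ⊎ (Pinched j x × Pinched j y) → pinch j x ≡ pinch j y
  from (inj₁ refl)     = refl
  from (inj₂ (px , py)) = trans (Pinched⇒pinch≡ j px) (sym (Pinched⇒pinch≡ j py))

pinch-window : ∀ K t (j : Fin s) → ∃ λ t′ →
  ∀ x → InWindow K t (toℕ x) → InWindow K t′ (toℕ (pinch j x))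
pinch-window K t j with t ≤? suc (toℕ j)
... | yes t≤1+j = t , below
  where
  below : ∀ x → InWindow K t (toℕ x) → InWindow K t (toℕ (pinch j x))
  below x w with toℕ-pinch j x
  ... | inj₁ (_ , eq)  = subst (InWindow K t) (sym eq) w
  ... | inj₂ (j<x , _) = ⊥-elim (<⇒≱ j<x (s≤s⁻¹ (≤-trans (proj₂ w) t≤1+j)))
... | no t≰1+j with ≰⇒> t≰1+j
... | s≤s {n = u} j<u = u , above
  where
  above : ∀ x → InWindow K (suc u) (toℕ x) → InWindow K u (toℕ (pinch j x))
  above x (t≤x+K , x<t) with toℕ-pinch j x
  ... | inj₁ (x≤j , eq) = subst (InWindow K u) (sym eq) (≤-trans (n≤1+n u) t≤x+K , ≤-<-trans x≤j j<u)
  ... | inj₂ (_ , eq) rewrite sym eq = s≤s⁻¹ t≤x+K , s≤s⁻¹ x<t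

⌊n/2⌋+⌊n/2⌋≤n : ∀ n → ⌊ n /2⌋ + ⌊ n /2⌋ ≤ n
⌊n/2⌋+⌊n/2⌋≤n n = ≤-trans (+-monoʳ-≤ ⌊ n /2⌋ (⌊n/2⌋≤⌈n/2⌉ n)) (≤-reflexive (⌊n/2⌋+⌈n/2⌉≡n n))

n≤1+⌊n/2⌋+⌊n/2⌋ : ∀ n → n ≤ suc (⌊ n /2⌋ + ⌊ n /2⌋)
n≤1+⌊n/2⌋+⌊n/2⌋ zero          = z≤n
n≤1+⌊n/2⌋+⌊n/2⌋ (suc zero)    = s≤s z≤n
n≤1+⌊n/2⌋+⌊n/2⌋ (suc (suc n)) =
  s≤s (s≤s (subst (n ≤_) (sym (+-suc ⌊ n /2⌋ ⌊ n /2⌋)) (n≤1+⌊n/2⌋+⌊n/2⌋ n)))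

-- Labels 0,1 ↦ 0, 2,3 ↦ 1, …, capped at m so that an odd last label joins the last pair.
pairLabel : ℕ → ℕ → ℕ
pairLabel m X = ⌊ X /2⌋ ⊓ m

pairLabel-double : ∀ {m A} → A ≤ m → pairLabel m (A + A) ≡ A
pairLabel-double {m} {A} A≤m = trans (cong (_⊓ m) (sym (n≡⌊n+n/2⌋ A))) (m≤n⇒m⊓n≡m A≤m)

pairLabel-double+1 : ∀ {m A} → A ≤ m → pairLabel m (suc (A + A)) ≡ A
pairLabel-double+1 {m} {A} A≤m = trans (cong (_⊓ m) (sym (n≡⌈n+n/2⌉ A))) (m≤n⇒m⊓n≡m A≤m)

pairLabel-close : ∀ m {X P} → P ≤ X → X ≤ suc P → P ≤ suc (m + m) →
  let G = pairLabel m X in G + G ≤ suc P × P ≤ suc (G + G)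
pairLabel-close m {X} {P} P≤X X≤1+P P≤1+2m =
  ≤-trans (+-mono-≤ (m⊓n≤m ⌊ X /2⌋ m) (m⊓n≤m ⌊ X /2⌋ m)) (≤-trans (⌊n/2⌋+⌊n/2⌋≤n X) X≤1+P) ,
  [ (λ eq → subst (λ G → P ≤ suc (G + G)) (sym eq) (≤-trans P≤X (n≤1+⌊n/2⌋+⌊n/2⌋ X)))
  , (λ eq → subst (λ G → P ≤ suc (G + G)) (sym eq) P≤1+2m)
  ]′ (⊓-sel ⌊ X /2⌋ m)

InWindow-double : ∀ {k t G P} → InWindow k t G → G + G ≤ suc P → P ≤ suc (G + G) →
  InWindow (2 * suc k) (t + t) P
InWindow-double {k} {t} {G} {P} (t≤G+k , G<t) 2G≤1+P P≤1+2G = lower , upper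
  where
  open ≤-Reasoning
  regroup : ∀ G k → (G + k) + (G + k) ≡ (G + G) + (k + k)
  regroup = solve-∀
  shift : ∀ P k → suc (suc P + (k + k)) ≡ P + 2 * suc k
  shift = solve-∀
  lower : t + t ≤ P + 2 * suc k
  lower = begin
    t + t               ≤⟨ +-mono-≤ t≤G+k t≤G+k ⟩
    (G + k) + (G + k)   ≡⟨ regroup G k ⟩
    (G + G) + (k + k)   ≤⟨ +-monoˡ-≤ (k + k) 2G≤1+P ⟩
    suc P + (k + k)     ≤⟨ n≤1+n _ ⟩
    suc (suc P + (k + k)) ≡⟨ shift P k ⟩
    P + 2 * suc k       ∎
  upper : P < t + t
  upper = begin-strict
    P                   <⟨ s≤s P≤1+2G ⟩
    suc (suc (G + G))   ≡⟨ cong suc (sym (+-suc G G)) ⟩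
    suc G + suc G       ≤⟨ +-mono-≤ G<t G<t ⟩
    t + t               ∎

module Merging {n s} (f : Fin n → Fin (suc (suc s))) (mono : Monotonic₁ _≤ᶠ_ _≤ᶠ_ f)
                     (onto : ∀ a → ∃ λ i → f i ≡ a) where

  D : Division n
  D = division f mono onto

  merge : Fin (suc s) → Division n
  merge j = division (pinch j ∘ f) (λ i≤i′ → Fin.pinch-mono-≤ j (mono i≤i′)) merged-onto
    where
    merged-onto : ∀ b → ∃ λ i → pinch j (f i) ≡ b
    merged-onto b = let (x , x↦b) = Fin.pinch-surjective j b ; (i , fi≡x) = onto x in i , x↦b fi≡x

  merge-step : ∀ j → MergeStep D (merge j)
  merge-step j = inject₁ j , fsuc j , suc≢inject₁ ∘ sym , λ i i′ → pinch-≡-⇔ j (f i) (f i′)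

  merge-keeps-others : ∀ {M : Matrix n} {K} j {b} → b ≢ j → KDiagonal M K D → ¬ RowWide M K (merge j) b
  merge-keeps-others {M} {K} j {b} b≢j diagonal W =
    proj₁ (diagonal a) (RowWide-transfer {M = M} {D = D} {E = merge j} ≤-refl rows windows W)
    where
    a = proj₁ (Fin.pinch-surjective j b)
    a↦b : pinch j a ≡ b
    a↦b = proj₂ (Fin.pinch-surjective j b) refl
    rows : ∀ i → pinch j (f i) ≡ b → f i ≡ a
    rows i fi↦b with Equivalence.to (pinch-≡-⇔ j (f i) a) (trans fi↦b (sym a↦b))
    ... | inj₁ fi≡a             = fi≡a
    ... | inj₂ (_ , a-pinched)  = ⊥-elim (b≢j (trans (sym a↦b) (Pinched⇒pinch≡ j a-pinched)))
    windows : ∀ t → InWindow K t (toℕ a) → ∃ λ t′ →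
      ∀ c → InWindow K t (toℕ (f c)) → InWindow K t′ (toℕ (pinch j (f c)))
    windows t _ = let (t′ , window) = pinch-window K t j in t′ , window ∘ f

  merge-diagonal-unless-wide : ∀ {M : Matrix n} → Symmetric M → ∀ {K} j →
    KDiagonal M K D → ¬ RowWide M K (merge j) j → KDiagonal M K (merge j)
  merge-diagonal-unless-wide {M} S {K} j diagonal ¬wide = KDiagonal-fromRows S {K} {merge j} notWide
    where
    notWide : ∀ b → ¬ RowWide M K (merge j) b
    notWide b with b Fin.≟ j
    ... | yes refl = ¬wide
    ... | no  b≢j  = merge-keeps-others {M} j b≢j diagonal

  m : ℕ
  m = ⌊ s /2⌋

  pair : Fin n → Fin (suc m)
  pair i = fromℕ< (s≤s (m⊓n≤n ⌊ toℕ (f i) /2⌋ m))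

  toℕ-pair : ∀ i → toℕ (pair i) ≡ pairLabel m (toℕ (f i))
  toℕ-pair i = Fin.toℕ-fromℕ< _

  twice : Fin (suc m) → Fin (suc s)
  twice a = fromℕ< (s≤s (≤-trans (+-mono-≤ a≤m a≤m) (⌊n/2⌋+⌊n/2⌋≤n s)))
    where a≤m = s≤s⁻¹ (Fin.toℕ<n a)

  toℕ-twice : ∀ a → toℕ (twice a) ≡ toℕ a + toℕ a
  toℕ-twice a = Fin.toℕ-fromℕ< _

  pair-≡ : ∀ i a → Pinched (twice a) (f i) → pair i ≡ a
  pair-≡ i a fi-pinched = Fin.toℕ-injective (trans (toℕ-pair i) (label fi-pinched))
    where
    a≤m = s≤s⁻¹ (Fin.toℕ<n a)
    label : Pinched (twice a) (f i) → pairLabel m (toℕ (f i)) ≡ toℕ a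
    label (inj₁ fi≡) = trans (cong (pairLabel m) (trans (cong toℕ fi≡)
                         (trans (Fin.toℕ-inject₁ (twice a)) (toℕ-twice a)))) (pairLabel-double a≤m)
    label (inj₂ fi≡) = trans (cong (pairLabel m) (trans (cong toℕ fi≡) (cong suc (toℕ-twice a))))
                         (pairLabel-double+1 a≤m)

  pairs : Division n
  pairs = division pair pair-mono pair-onto
    where
    pair-mono : Monotonic₁ _≤ᶠ_ _≤ᶠ_ pair
    pair-mono {i} {i′} i≤i′ = subst₂ _≤_ (sym (toℕ-pair i)) (sym (toℕ-pair i′))
                                (⊓-monoˡ-≤ m (⌊n/2⌋-mono (mono i≤i′)))
    pair-onto : ∀ a → ∃ λ i → pair i ≡ a
    pair-onto a = let (i , fi≡) = onto (inject₁ (twice a)) in i , pair-≡ i a (inj₁ fi≡)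

  pairs-wide : ∀ {M : Matrix n} {k} → (∀ j → RowWide M (2 * suc k) (merge j) j) →
               ∀ a → RowWide M k pairs a
  pairs-wide {M} {k} merged-wide a =
    RowWide-transfer {M = M} {D = pairs} {E = merge j} k≤2k+2
      (λ i fi↦j → pair-≡ i a (pinch≡⇒Pinched j fi↦j)) windows (merged-wide j)
    where
    j = twice a
    k≤2k+2 : k ≤ 2 * suc k
    k≤2k+2 = ≤-trans (n≤1+n k) (m≤m+n (suc k) _)
    windows : ∀ t → InWindow k t (toℕ a) → ∃ λ t′ →
      ∀ c → InWindow k t (toℕ (pair c)) → InWindow (2 * suc k) t′ (toℕ (pinch j (f c)))
    windows t _ = t + t , λ c w →
      let P≤s = s≤s⁻¹ (Fin.toℕ<n (pinch j (f c)))
          (lower , upper) = pairLabel-close m (toℕ-pinch-≤ j (f c)) (toℕ-≤-suc-pinch j (f c))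
                                              (≤-trans P≤s (n≤1+⌊n/2⌋+⌊n/2⌋ s))
      in InWindow-double (subst (InWindow k t) (toℕ-pair c) w) lower upper

  merge-diagonal : ∀ {M : Matrix n} → Symmetric M → ∀ {k} → ¬ Σ (Division n) (KWide M k) →
    KDiagonal M (2 * suc k) D → ∃ λ j → KDiagonal M (2 * suc k) (merge j)
  merge-diagonal {M} S {k} noWide diagonal = choose (Fin.all? mergedWide?)
    where
    K = 2 * suc k
    mergedWide? : ∀ j → Dec (RowWide M K (merge j) j)
    mergedWide? j = RowWide? M K (merge j) j
    choose : Dec (∀ j → RowWide M K (merge j) j) → ∃ λ j → KDiagonal M K (merge j)
    choose (yes merged-wide) =
      let wide = pairs-wide {M} {k} merged-wide in
      ⊥-elim (noWide (pairs , λ a → wide a , RowWide⇒ColWide S {k} {pairs} (wide a)))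
    choose (no ¬merged-wide) =
      let (j , ¬wide) = Fin.¬∀⟶∃¬ _ _ mergedWide? ¬merged-wide
      in j , merge-diagonal-unless-wide {M} S j diagonal ¬wide

data MergeChain {n} (M : Matrix n) (K : ℕ) (D : Division n) : Set where
  done : KDiagonal M K D → OnePart D → MergeChain M K D
  step : ∀ {E} → MergeStep D E → KDiagonal M K D → MergeChain M K E → MergeChain M K D

module _ {n} {M : Matrix n} {K : ℕ} where

  chain-length : ∀ {D} → MergeChain M K D → ℕ
  chain-length (done _ _)     = 0
  chain-length (step _ _ c)   = suc (chain-length c)

  chain-stage : ∀ {D} (c : MergeChain M K D) → Fin (suc (chain-length c)) → Division n
  chain-stage {D} c            fzero    = D
  chain-stage     (step _ _ c) (fsuc t) = chain-stage c t

  chain-last : ∀ {D} (c : MergeChain M K D) → OnePart (chain-stage c (fromℕ (chain-length c)))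
  chain-last (done _ one)  = one
  chain-last (step _ _ c)  = chain-last c

  chain-step : ∀ {D} (c : MergeChain M K D) (t : Fin (chain-length c)) →
    MergeStep (chain-stage c (inject₁ t)) (chain-stage c (fsuc t))
  chain-step (step merge _ _) fzero    = merge
  chain-step (step _ _ c)     (fsuc t) = chain-step c t

  chain-diagonal : ∀ {D} (c : MergeChain M K D) t → KDiagonal M K (chain-stage c t)
  chain-diagonal (done diagonal _)   fzero    = diagonal
  chain-diagonal (step _ diagonal _) fzero    = diagonal
  chain-diagonal (step _ _ c)        (fsuc t) = chain-diagonal c t

  MergeChain⇒SymDiagSeq : ∀ {D} → Singletons D → MergeChain M K D → SymDiagSeq M K
  MergeChain⇒SymDiagSeq singles c = record
    { len = chain-length c ; stage = chain-stage c ; first = singles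
    ; last = chain-last c ; step = chain-step c ; diagonal = chain-diagonal c }

diagonal-chain : ∀ {n} {M : Matrix n} → Symmetric M → ∀ {k} → ¬ Σ (Division n) (KWide M k) →
  ∀ s (f : Fin n → Fin (suc s)) (mono : Monotonic₁ _≤ᶠ_ _≤ᶠ_ f) (onto : ∀ a → ∃ λ i → f i ≡ a) →
  KDiagonal M (2 * suc k) (division f mono onto) → MergeChain M (2 * suc k) (division f mono onto)
diagonal-chain S noWide zero    f mono onto diagonal = done diagonal refl
diagonal-chain S noWide (suc s) f mono onto diagonal =
  let (j , diagonal′) = merge-diagonal S noWide diagonal in
  step (merge-step j) diagonal
    (diagonal-chain S noWide s (part (merge j)) (monotone (merge j)) (surjective (merge j)) diagonal′)
  where open Merging f mono onto

theorem19 : (n : ℕ) (M : Matrix n) → Symmetric M → (k : ℕ) →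
    ¬ (Σ (Division n) (KWide M k)) → SymDiagSeq M (2 * suc k)
-- Without rows, the division with no parts is vacuously k-wide.
theorem19 zero    M S k noWide = ⊥-elim (noWide (singletons zero , λ ()))
theorem19 (suc n) M S k noWide =
  MergeChain⇒SymDiagSeq (λ _ _ → id)
    (diagonal-chain S noWide n id id (λ a → a , refl) (singletons-diagonal S (*-monoʳ-≤ 2 (s≤s z≤n))))
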